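{- Let $\alpha\in\mathbb Z\setminus\{0,1\}$ and let $(h_n)$ be the sequence with $h_0=0$, $h_1=1$, $h_2=-\alpha^2(\alpha-1)$, $h_3=-\alpha^6(\alpha-1)^3$, $h_4=\alpha^{11}(\alpha-1)^6$, and for $m\ge2$: $h_{2m+1}=h_{m+2}h_m^3-h_{m-1}h_{m+1}^3$, for $m\ge 3$: $h_{2m}=h_m\big(h_{m+2}h_{m-1}^2-h_{m-2}h_{m+1}^2\big)/h_2$. (i) If $n\equiv 1,13\pmod{14}$, then $h_n$ is a square. (ii) If $n\equiv 1,3,8,13,18,20\pmod{21}$, then $h_n$ is a cube.
   Context: The sequence defined is the elliptic divisibility sequence attached to the point $(0,0)$ of order $7$ on the Tate normal form curve with $b=\alpha^3-\alpha^2$, $c=\alpha^2-\alpha$; its seventh term is zero. Convention: an integer $m$ is called a square if $m=\pm\beta^2$ for some nonzero integer $\beta$, and a cube if $m=\beta^3$ for some nonzero integer $\beta$. -}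

module Defs where

open import Data.Nat as ℕ using (ℕ; suc; _%_)
open import Data.Integer using (ℤ; +_; -_; _*_; _-_; _^_)
open import Data.Product using (Σ; ∃; _×_; _,_)
open import Data.Sum using (_⊎_)
open import Relation.Binary.PropositionalEquality using (_≡_; _≢_)

IsSquare : ℤ → Set
IsSquare m = Σ ℤ λ β → β ≢ + 0 × (m ≡ β ^ 2 ⊎ m ≡ - (β ^ 2))

IsCube : ℤ → Set
IsCube m = Σ ℤ λ β → β ≢ + 0 × m ≡ β ^ 3

-- The division by h_2
-- in the even recurrence is written multiplicatively (h_2 ≠ 0 since α ∉ {0,1},
-- so this determines h_{2m} uniquely and equals the exact quotient).
IsHSeq : ℤ → (ℕ → ℤ) → Set
IsHSeq α h =
    h 0 ≡ + 0
  × h 1 ≡ + 1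
  × h 2 ≡ - (α ^ 2 * (α - + 1))
  × h 3 ≡ - (α ^ 6 * (α - + 1) ^ 3)
  × h 4 ≡ α ^ 11 * (α - + 1) ^ 6
  × (∀ k → let m = k ℕ.+ 2 in
       h (2 ℕ.* m ℕ.+ 1) ≡ h (m ℕ.+ 2) * h m ^ 3 - h (k ℕ.+ 1) * h (m ℕ.+ 1) ^ 3)
  × (∀ k → let m = k ℕ.+ 3 in
       h 2 * h (2 ℕ.* m) ≡ h m * (h (m ℕ.+ 2) * h (k ℕ.+ 2) ^ 2 - h (k ℕ.+ 1) * h (m ℕ.+ 1) ^ 2))

module Submission where

-- The recurrences determine (h_n) once h₂ ≠ 0, so we exhibit an explicit
-- solution and read both claims off it.  With β = α - 1, A = α³⁵β²¹ and
-- B = α¹⁰β⁶, the solution is the signed monomial ψ given by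
--   ψ_0, …, ψ_6 = 0, 1, -α²β, -α⁶β³, α¹¹β⁶, α¹⁷β¹⁰, -α²⁵β¹⁵,   ψ_{n+7} = A Bⁿ ψ_n.
-- Since A² = B⁷ it is quasi-periodic: ψ_{7q+n} = A^{q²}B^{qn} ψ_n.  Both
-- recurrences are homogeneous for such "quadratic" factors, so the
-- recurrences at k = 7q + r follow from those at r < 7, i.e. from fourteen
-- explicit identities between monomials.  Quasi-periodicity with q = 2t
-- (resp. 3t) gives ψ_{14t+ρ} = u² ψ_ρ (resp. ψ_{21t+ρ} = u³ ψ_ρ), so it
-- remains to see that ψ_ρ is a square (resp. a cube) for the listed ρ.

open import Defs
open import Data.Nat using (ℕ; _%_)
open import Data.Integer using (ℤ; +_)
open import Data.Product using (_×_)
open import Data.Sum using (_⊎_)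
open import Relation.Binary.PropositionalEquality using (_≡_; _≢_)

open import Data.Nat as Nat using (zero; suc; _<_; _/_; s≤s)
import Data.Nat.Properties as ℕP
import Data.Nat.Tactic.RingSolver as ℕSolver
open import Data.Nat.DivMod using (m≡m%n+[m/n]*n; m%n<n)
open import Data.Nat.Induction using (<-rec)
open import Data.Product using (Σ; _,_; proj₁; proj₂)
open import Data.Sum using (inj₁; inj₂)
open import Relation.Binary.PropositionalEquality
  using (refl; sym; trans; cong; cong₂; subst; module ≡-Reasoning)

module Arithmetic where
  open Nat using (_+_; _*_)

  below : ∀ {i n} d → suc (i + d) ≡ n → i < n
  below {i} d refl = s≤s (ℕP.m≤m+n i d)

  divide7 : ∀ n → Σ ℕ λ q → Σ ℕ λ r → r < 7 × n ≡ q * 7 + r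
  divide7 n = n / 7 , n % 7 , m%n<n n 7
            , trans (m≡m%n+[m/n]*n n 7) (ℕP.+-comm (n % 7) (n / 7 * 7))

  recurrence-shape : ∀ j → Σ ℕ λ k → 5 + j ≡ 2 * (k + 2) + 1 ⊎ 5 + j ≡ 2 * (k + 3)
  recurrence-shape 0 = 0 , inj₁ refl
  recurrence-shape 1 = 0 , inj₂ refl
  recurrence-shape (suc (suc j)) with recurrence-shape j
  ... | k , inj₁ e = suc k , inj₁ (trans (cong (λ x → 2 + x) e) (shift k))
    where
    shift : ∀ k → 2 + (2 * (k + 2) + 1) ≡ 2 * (suc k + 2) + 1
    shift = ℕSolver.solve-∀
  ... | k , inj₂ e = suc k , inj₂ (trans (cong (λ x → 2 + x) e) (shift k))
    where
    shift : ∀ k → 2 + 2 * (k + 3) ≡ 2 * (suc k + 3)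
    shift = ℕSolver.solve-∀

  odd-indices-below : ∀ k → let n = 2 * (k + 2) + 1 in
    k + 2 + 2 < n × k + 2 < n × k + 1 < n × k + 2 + 1 < n
  odd-indices-below k = below k (e₁ k) , below (k + 2) (e₂ k) , below (k + 3) (e₃ k) , below (k + 1) (e₄ k)
    where
    e₁ : ∀ k → suc (k + 2 + 2 + k) ≡ 2 * (k + 2) + 1
    e₁ = ℕSolver.solve-∀
    e₂ : ∀ k → suc (k + 2 + (k + 2)) ≡ 2 * (k + 2) + 1
    e₂ = ℕSolver.solve-∀
    e₃ : ∀ k → suc (k + 1 + (k + 3)) ≡ 2 * (k + 2) + 1
    e₃ = ℕSolver.solve-∀
    e₄ : ∀ k → suc (k + 2 + 1 + (k + 1)) ≡ 2 * (k + 2) + 1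
    e₄ = ℕSolver.solve-∀

  even-indices-below : ∀ k → let n = 2 * (k + 3) in
    k + 3 < n × k + 3 + 2 < n × k + 2 < n × k + 1 < n × k + 3 + 1 < n
  even-indices-below k = below (k + 2) (e₁ k) , below k (e₂ k) , below (k + 3) (e₃ k)
                       , below (k + 4) (e₄ k) , below (k + 1) (e₅ k)
    where
    e₁ : ∀ k → suc (k + 3 + (k + 2)) ≡ 2 * (k + 3)
    e₁ = ℕSolver.solve-∀
    e₂ : ∀ k → suc (k + 3 + 2 + k) ≡ 2 * (k + 3)
    e₂ = ℕSolver.solve-∀
    e₃ : ∀ k → suc (k + 2 + (k + 3)) ≡ 2 * (k + 3)
    e₃ = ℕSolver.solve-∀
    e₄ : ∀ k → suc (k + 1 + (k + 4)) ≡ 2 * (k + 3)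
    e₄ = ℕSolver.solve-∀
    e₅ : ∀ k → suc (k + 3 + 1 + (k + 1)) ≡ 2 * (k + 3)
    e₅ = ℕSolver.solve-∀

  -- quadratic u v q n is the degree of A^{q²} B^{qn} in a variable in which
  -- A has degree u and B has degree v.
  quadratic : ℕ → ℕ → ℕ → ℕ → ℕ
  quadratic u v q n = u * q * q + v * q * n

  -- Passing from q to q + 1 multiplies A^{q²}B^{qn} by A B^{7q+n},
  -- provided A² = B⁷.
  quadratic-suc : ∀ u v → u * 2 ≡ v * 7 → ∀ q n →
    v * (q * 7 + n) + u + quadratic u v q n ≡ quadratic u v (suc q) n
  quadratic-suc u v A²≡B⁷ q n = begin
    v * (q * 7 + n) + u + quadratic u v q n  ≡⟨ expand₁ u v q n ⟩
    v * 7 * q + rest                         ≡⟨ cong (λ w → w * q + rest) (sym A²≡B⁷) ⟩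
    u * 2 * q + rest                         ≡⟨ expand₂ u v q n ⟩
    quadratic u v (suc q) n                  ∎
    where
    open ≡-Reasoning
    rest : ℕ
    rest = v * n + u + u * q * q + v * q * n
    expand₁ : ∀ u v q n → v * (q * 7 + n) + u + (u * q * q + v * q * n)
                        ≡ v * 7 * q + (v * n + u + u * q * q + v * q * n)
    expand₁ = ℕSolver.solve-∀
    expand₂ : ∀ u v q n → u * 2 * q + (v * n + u + u * q * q + v * q * n)
                        ≡ u * (1 + q) * (1 + q) + v * (1 + q) * n
    expand₂ = ℕSolver.solve-∀

  -- Four factors A^{q²}B^{qa}, … whose linear indices add up to 2p
  -- multiply to A^{(2q)²}B^{2qp}.
  quadratic-double : ∀ u v q a b c d p → a + b + c + d ≡ p * 2 →
    quadratic u v q a + quadratic u v q b + quadratic u v q c + quadratic u v q d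
      ≡ quadratic u v (q * 2) p
  quadratic-double u v q a b c d p weights = begin
    quadratic u v q a + quadratic u v q b + quadratic u v q c + quadratic u v q d
      ≡⟨ expand₁ u v q a b c d ⟩
    u * q * q * 4 + v * q * (a + b + c + d)  ≡⟨ cong (λ w → u * q * q * 4 + v * q * w) weights ⟩
    u * q * q * 4 + v * q * (p * 2)          ≡⟨ expand₂ u v q p ⟩
    quadratic u v (q * 2) p                  ∎
    where
    open ≡-Reasoning
    expand₁ : ∀ u v q a b c d →
      (u * q * q + v * q * a) + (u * q * q + v * q * b) + (u * q * q + v * q * c) + (u * q * q + v * q * d)
        ≡ u * q * q * 4 + v * q * (a + b + c + d)
    expand₁ = ℕSolver.solve-∀
    expand₂ : ∀ u v q p → u * q * q * 4 + v * q * (p * 2) ≡ u * (q * 2) * (q * 2) + v * (q * 2) * p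
    expand₂ = ℕSolver.solve-∀

  -- A^{(kq)²}B^{kqn} is the k-th power of (A^k)^{q²}B^{qn}.
  quadratic-scale : ∀ u v q n k → quadratic u v (q * k) n ≡ quadratic (u * k) v q n * k
  quadratic-scale = expand
    where
    expand : ∀ u v q n k → u * (q * k) * (q * k) + v * (q * k) * n ≡ (u * k * q * q + v * q * n) * k
    expand = ℕSolver.solve-∀

  +-assoc₃ : ∀ x r a b → x + r + a + b ≡ x + (r + a + b)
  +-assoc₃ x r a b = trans (cong (_+ b) (ℕP.+-assoc x r a)) (ℕP.+-assoc x (r + a) b)

  doubled-index : ∀ q r c → 2 * (q * 7 + r + c) ≡ q * 2 * 7 + 2 * (r + c)
  doubled-index = ℕSolver.solve-∀

  residue-index : ∀ k t ρ → ρ + t * (k * 7) ≡ t * k * 7 + ρ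
  residue-index = ℕSolver.solve-∀

  odd-weights : ∀ r → (r + 2 + 2 + (r + 2) + (r + 2) + (r + 2) ≡ (2 * (r + 2) + 1) * 2)
                    × (r + 1 + (r + 2 + 1) + (r + 2 + 1) + (r + 2 + 1) ≡ (2 * (r + 2) + 1) * 2)
  odd-weights r = w₁ r , w₂ r
    where
    w₁ : ∀ r → r + 2 + 2 + (r + 2) + (r + 2) + (r + 2) ≡ (2 * (r + 2) + 1) * 2
    w₁ = ℕSolver.solve-∀
    w₂ : ∀ r → r + 1 + (r + 2 + 1) + (r + 2 + 1) + (r + 2 + 1) ≡ (2 * (r + 2) + 1) * 2
    w₂ = ℕSolver.solve-∀

  even-weights : ∀ r → (r + 3 + (r + 3 + 2) + (r + 2) + (r + 2) ≡ 2 * (r + 3) * 2)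
                     × (r + 3 + (r + 1) + (r + 3 + 1) + (r + 3 + 1) ≡ 2 * (r + 3) * 2)
  even-weights r = w₁ r , w₂ r
    where
    w₁ : ∀ r → r + 3 + (r + 3 + 2) + (r + 2) + (r + 2) ≡ 2 * (r + 3) * 2
    w₁ = ℕSolver.solve-∀
    w₂ : ∀ r → r + 3 + (r + 1) + (r + 3 + 1) + (r + 3 + 1) ≡ 2 * (r + 3) * 2
    w₂ = ℕSolver.solve-∀

open Arithmetic

open import Data.Integer as ℤ using (_*_; _-_; _^_; -_)
import Data.Integer.Properties as ℤP
import Data.Integer.Tactic.RingSolver as ℤSolver
open ≡-Reasoning

*-≢0 : ∀ {x y} → x ≢ + 0 → y ≢ + 0 → x * y ≢ + 0
*-≢0 {x} x≢0 y≢0 xy≡0 with ℤP.i*j≡0⇒i≡0∨j≡0 x xy≡0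
... | inj₁ x≡0 = x≢0 x≡0
... | inj₂ y≡0 = y≢0 y≡0

^-≢0 : ∀ {x} n → x ≢ + 0 → x ^ n ≢ + 0
^-≢0 {x} n x≢0 xⁿ≡0 = x≢0 (ℤP.i^n≡0⇒i≡0 x n xⁿ≡0)

^-distrib-* : ∀ x y n → (x * y) ^ n ≡ x ^ n * y ^ n
^-distrib-* x y zero    = refl
^-distrib-* x y (suc n) = trans (cong ((x * y) *_) (^-distrib-* x y n)) (interchange x y (x ^ n) (y ^ n))
  where
  interchange : ∀ a b c d → a * b * (c * d) ≡ a * c * (b * d)
  interchange = ℤSolver.solve-∀

square-scale : ∀ {u m} → u ≢ + 0 → IsSquare m → IsSquare (u ^ 2 * m)
square-scale {u} u≢0 (w , w≢0 , inj₁ refl) = u * w , *-≢0 u≢0 w≢0 , inj₁ (sym (^-distrib-* u w 2))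
square-scale {u} u≢0 (w , w≢0 , inj₂ refl) =
  u * w , *-≢0 u≢0 w≢0 , inj₂ (trans (sym (ℤP.neg-distribʳ-* (u ^ 2) (w ^ 2))) (cong -_ (sym (^-distrib-* u w 2))))

cube-scale : ∀ {u m} → u ≢ + 0 → IsCube m → IsCube (u ^ 3 * m)
cube-scale {u} u≢0 (w , w≢0 , refl) = u * w , *-≢0 u≢0 w≢0 , sym (^-distrib-* u w 3)

*-distribˡ-- : ∀ t a b → t * (a - b) ≡ t * a - t * b
*-distribˡ-- = ℤSolver.solve-∀

-- Used with tᵢ = A^{q²}B^{qnᵢ}.
odd-twist : ∀ {t₀} t₁ t₂ t₃ t₄ x₀ x₁ x₂ x₃ x₄ →
  t₁ * t₂ * t₂ * t₂ ≡ t₀ → t₃ * t₄ * t₄ * t₄ ≡ t₀ →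
  x₀ ≡ x₁ * x₂ ^ 3 - x₃ * x₄ ^ 3 →
  t₀ * x₀ ≡ (t₁ * x₁) * (t₂ * x₂) ^ 3 - (t₃ * x₃) * (t₄ * x₄) ^ 3
odd-twist {t₀} t₁ t₂ t₃ t₄ x₀ x₁ x₂ x₃ x₄ weights₁ weights₂ recurrence = begin
  t₀ * x₀                                                   ≡⟨ cong (t₀ *_) recurrence ⟩
  t₀ * (x₁ * x₂ ^ 3 - x₃ * x₄ ^ 3)                          ≡⟨ *-distribˡ-- t₀ (x₁ * x₂ ^ 3) (x₃ * x₄ ^ 3) ⟩
  t₀ * (x₁ * x₂ ^ 3) - t₀ * (x₃ * x₄ ^ 3)                   ≡⟨ cong₂ _-_ (regroup t₁ t₂ x₁ x₂ weights₁)
                                                                         (regroup t₃ t₄ x₃ x₄ weights₂) ⟩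
  (t₁ * x₁) * (t₂ * x₂) ^ 3 - (t₃ * x₃) * (t₄ * x₄) ^ 3     ∎
  where
  regroup : ∀ {t} s u x y → s * u * u * u ≡ t → t * (x * y ^ 3) ≡ (s * x) * (u * y) ^ 3
  regroup s u x y refl = identity s u x y
    where
    -- Powers are written out: the ring solver does not interpret _^_.
    identity : ∀ s u x y → s * u * u * u * (x * (y * (y * (y * + 1))))
                         ≡ (s * x) * ((u * y) * ((u * y) * ((u * y) * + 1)))
    identity = ℤSolver.solve-∀

even-twist : ∀ {t₀} c t₁ t₂ t₃ t₄ t₅ x₀ x₁ x₂ x₃ x₄ x₅ →
  t₁ * t₂ * t₃ * t₃ ≡ t₀ → t₁ * t₄ * t₅ * t₅ ≡ t₀ →
  c * x₀ ≡ x₁ * (x₂ * x₃ ^ 2 - x₄ * x₅ ^ 2) →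
  c * (t₀ * x₀) ≡ (t₁ * x₁) * ((t₂ * x₂) * (t₃ * x₃) ^ 2 - (t₄ * x₄) * (t₅ * x₅) ^ 2)
even-twist {t₀} c t₁ t₂ t₃ t₄ t₅ x₀ x₁ x₂ x₃ x₄ x₅ weights₁ weights₂ recurrence = begin
  c * (t₀ * x₀)                                            ≡⟨ swap c t₀ x₀ ⟩
  t₀ * (c * x₀)                                            ≡⟨ cong (t₀ *_) recurrence ⟩
  t₀ * (x₁ * (x₂ * x₃ ^ 2 - x₄ * x₅ ^ 2))                  ≡⟨ cong (t₀ *_) (*-distribˡ-- x₁ _ _) ⟩
  t₀ * (x₁ * (x₂ * x₃ ^ 2) - x₁ * (x₄ * x₅ ^ 2))           ≡⟨ *-distribˡ-- t₀ _ _ ⟩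
  t₀ * (x₁ * (x₂ * x₃ ^ 2)) - t₀ * (x₁ * (x₄ * x₅ ^ 2))   ≡⟨ cong₂ _-_ (regroup t₁ t₂ t₃ x₁ x₂ x₃ weights₁)
                                                                        (regroup t₁ t₄ t₅ x₁ x₄ x₅ weights₂) ⟩
  (t₁ * x₁) * ((t₂ * x₂) * (t₃ * x₃) ^ 2) - (t₁ * x₁) * ((t₄ * x₄) * (t₅ * x₅) ^ 2)
                                                           ≡⟨ sym (*-distribˡ-- (t₁ * x₁) _ _) ⟩
  (t₁ * x₁) * ((t₂ * x₂) * (t₃ * x₃) ^ 2 - (t₄ * x₄) * (t₅ * x₅) ^ 2)  ∎
  where
  swap : ∀ a b d → a * (b * d) ≡ b * (a * d)
  swap = ℤSolver.solve-∀
  regroup : ∀ {t} s u v x y z → s * u * v * v ≡ t → t * (x * (y * z ^ 2)) ≡ (s * x) * ((u * y) * (v * z) ^ 2)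
  regroup s u v x y z refl = identity s u v x y z
    where
    identity : ∀ s u v x y z → s * u * v * v * (x * (y * (z * (z * + 1))))
                             ≡ (s * x) * ((u * y) * ((v * z) * ((v * z) * + 1)))
    identity = ℤSolver.solve-∀

-- A signed monomial c αⁱ βʲ in α and β = α - 1, kept as its data so that
-- products of explicit monomials compute.
record Monomial : Set where
  constructor _·α^_·β^_
  field
    coefficient : ℤ
    α-degree β-degree : ℕ

infix 5 _·α^_·β^_
infixl 7 _⊗_
infixl 8 _⊗^_

_⊗_ : Monomial → Monomial → Monomial
(c ·α^ i ·β^ j) ⊗ (d ·α^ k ·β^ l) = c * d ·α^ i Nat.+ k ·β^ j Nat.+ l

_⊗^_ : Monomial → ℕ → Monomial
m ⊗^ zero  = + 1 ·α^ 0 ·β^ 0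
m ⊗^ suc n = m ⊗ m ⊗^ n

negate : Monomial → Monomial
negate (c ·α^ i ·β^ j) = - c ·α^ i ·β^ j

-- The factor A Bⁿ = α^{10n+35} β^{6n+21} relating ψ_{n+7} to ψ_n.
step : ℕ → Monomial
step n = + 1 ·α^ 10 Nat.* n Nat.+ 35 ·β^ 6 Nat.* n Nat.+ 21

ψ : ℕ → Monomial
ψ 0 = + 0 ·α^ 0 ·β^ 0
ψ 1 = + 1 ·α^ 0 ·β^ 0
ψ 2 = - + 1 ·α^ 2 ·β^ 1
ψ 3 = - + 1 ·α^ 6 ·β^ 3
ψ 4 = + 1 ·α^ 11 ·β^ 6
ψ 5 = + 1 ·α^ 17 ·β^ 10
ψ 6 = - + 1 ·α^ 25 ·β^ 15
ψ (suc (suc (suc (suc (suc (suc (suc n))))))) = step n ⊗ ψ n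

-- A^{q²}B^{qn}: the factor relating ψ_{7q+n} to ψ_n.
twist : ℕ → ℕ → Monomial
twist q n = + 1 ·α^ quadratic 35 10 q n ·β^ quadratic 21 6 q n

OddRecurrence : (ℕ → ℤ) → ℕ → Set
OddRecurrence f k =
  f (2 Nat.* (k Nat.+ 2) Nat.+ 1) ≡ f (k Nat.+ 2 Nat.+ 2) * f (k Nat.+ 2) ^ 3 - f (k Nat.+ 1) * f (k Nat.+ 2 Nat.+ 1) ^ 3

EvenRecurrence : (ℕ → ℤ) → ℕ → Set
EvenRecurrence f k =
  f 2 * f (2 Nat.* (k Nat.+ 3))
    ≡ f (k Nat.+ 3) * (f (k Nat.+ 3 Nat.+ 2) * f (k Nat.+ 2) ^ 2 - f (k Nat.+ 1) * f (k Nat.+ 3 Nat.+ 1) ^ 2)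

module ClosedForm (α : ℤ) where

  β : ℤ
  β = α - + 1

  ⟦_⟧ : Monomial → ℤ
  ⟦ c ·α^ i ·β^ j ⟧ = c * (α ^ i * β ^ j)

  Ψ : ℕ → ℤ
  Ψ n = ⟦ ψ n ⟧

  ⟦⊗⟧ : ∀ m m′ → ⟦ m ⊗ m′ ⟧ ≡ ⟦ m ⟧ * ⟦ m′ ⟧
  ⟦⊗⟧ (c ·α^ i ·β^ j) (d ·α^ k ·β^ l) =
    trans (cong₂ (λ a b → c * d * (a * b)) (ℤP.^-distribˡ-+-* α i k) (ℤP.^-distribˡ-+-* β j l))
          (interchange c d (α ^ i) (α ^ k) (β ^ j) (β ^ l))
    where
    interchange : ∀ c d a a′ b b′ → c * d * (a * a′ * (b * b′)) ≡ c * (a * b) * (d * (a′ * b′))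
    interchange = ℤSolver.solve-∀

  ⟦⊗^⟧ : ∀ m n → ⟦ m ⊗^ n ⟧ ≡ ⟦ m ⟧ ^ n
  ⟦⊗^⟧ m zero    = refl
  ⟦⊗^⟧ m (suc n) = trans (⟦⊗⟧ m (m ⊗^ n)) (cong (⟦ m ⟧ *_) (⟦⊗^⟧ m n))

  ⟦power⟧ : ∀ c a b k → ⟦ c ·α^ a Nat.* k ·β^ b Nat.* k ⟧ ≡ c * ⟦ + 1 ·α^ a ·β^ b ⟧ ^ k
  ⟦power⟧ c a b k = cong (c *_) (begin
    α ^ (a Nat.* k) * β ^ (b Nat.* k)  ≡⟨ sym (cong₂ _*_ (ℤP.^-*-assoc α a k) (ℤP.^-*-assoc β b k)) ⟩
    (α ^ a) ^ k * (β ^ b) ^ k          ≡⟨ sym (^-distrib-* (α ^ a) (β ^ b) k) ⟩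
    (α ^ a * β ^ b) ^ k                ≡⟨ cong (_^ k) (sym (ℤP.*-identityˡ (α ^ a * β ^ b))) ⟩
    ⟦ + 1 ·α^ a ·β^ b ⟧ ^ k            ∎)

  -- Elementary relations between monomials; each base case of the
  -- recurrences is an instance of one of them.
  minus-zero : ∀ m i j → ⟦ m ⟧ ≡ ⟦ m ⟧ - ⟦ + 0 ·α^ i ·β^ j ⟧
  minus-zero m i j = sym (ℤP.+-identityʳ ⟦ m ⟧)

  self-cancel : ∀ i j m → ⟦ + 0 ·α^ i ·β^ j ⟧ ≡ ⟦ m ⟧ - ⟦ m ⟧
  self-cancel i j m = sym (ℤP.+-inverseʳ ⟦ m ⟧)

  β-step : ∀ c i j → ⟦ c ·α^ i ·β^ suc j ⟧ ≡ ⟦ c ·α^ suc i ·β^ j ⟧ - ⟦ c ·α^ i ·β^ j ⟧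
  β-step c i j = identity c α (α ^ i) (β ^ j)
    where
    identity : ∀ c a x y → c * (x * ((a - + 1) * y)) ≡ c * (a * x * y) - c * (x * y)
    identity = ℤSolver.solve-∀

  zero-minus : ∀ m i j → ⟦ m ⟧ ≡ ⟦ + 0 ·α^ i ·β^ j ⟧ - ⟦ negate m ⟧
  zero-minus (c ·α^ k ·β^ l) i j = identity c (α ^ k * β ^ l) (α ^ i * β ^ j)
    where
    identity : ∀ c x y → c * x ≡ + 0 * y - - c * x
    identity = ℤSolver.solve-∀

  β-step′ : ∀ c i j → ⟦ c ·α^ i ·β^ suc j ⟧ ≡ ⟦ - c ·α^ i ·β^ j ⟧ - ⟦ - c ·α^ suc i ·β^ j ⟧
  β-step′ c i j = identity c α (α ^ i) (β ^ j)
    where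
    identity : ∀ c a x y → c * (x * ((a - + 1) * y)) ≡ - c * (x * y) - - c * (a * x * y)
    identity = ℤSolver.solve-∀

  -- Quasi-periodicity: ψ_{7q+n} = A^{q²}B^{qn} ψ_n, by induction on q
  -- using A² = B⁷ (35·2 = 10·7 and 21·2 = 6·7).
  Ψ-quasi-periodic : ∀ q n → Ψ (q Nat.* 7 Nat.+ n) ≡ ⟦ twist q n ⟧ * Ψ n
  Ψ-quasi-periodic zero    n = sym (ℤP.*-identityˡ (Ψ n))
  Ψ-quasi-periodic (suc q) n = begin
    ⟦ step m ⊗ ψ m ⟧                       ≡⟨ ⟦⊗⟧ (step m) (ψ m) ⟩
    ⟦ step m ⟧ * Ψ m                       ≡⟨ cong (⟦ step m ⟧ *_) (Ψ-quasi-periodic q n) ⟩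
    ⟦ step m ⟧ * (⟦ twist q n ⟧ * Ψ n)     ≡⟨ sym (ℤP.*-assoc ⟦ step m ⟧ ⟦ twist q n ⟧ (Ψ n)) ⟩
    ⟦ step m ⟧ * ⟦ twist q n ⟧ * Ψ n       ≡⟨ cong (_* Ψ n) (sym (⟦⊗⟧ (step m) (twist q n))) ⟩
    ⟦ step m ⊗ twist q n ⟧ * Ψ n           ≡⟨ cong (λ t → ⟦ t ⟧ * Ψ n) step-twist ⟩
    ⟦ twist (suc q) n ⟧ * Ψ n              ∎
    where
    m : ℕ
    m = q Nat.* 7 Nat.+ n
    step-twist : step m ⊗ twist q n ≡ twist (suc q) n
    step-twist = cong₂ (λ a b → + 1 ·α^ a ·β^ b) (quadratic-suc 35 10 refl q n) (quadratic-suc 21 6 refl q n)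

  Ψ-at : ∀ {i} q n → i ≡ q Nat.* 7 Nat.+ n → Ψ i ≡ ⟦ twist q n ⟧ * Ψ n
  Ψ-at q n refl = Ψ-quasi-periodic q n

  twist-product : ∀ q a b c d p → a Nat.+ b Nat.+ c Nat.+ d ≡ p Nat.* 2 →
    ⟦ twist q a ⟧ * ⟦ twist q b ⟧ * ⟦ twist q c ⟧ * ⟦ twist q d ⟧ ≡ ⟦ twist (q Nat.* 2) p ⟧
  twist-product q a b c d p weights = begin
    ⟦ twist q a ⟧ * ⟦ twist q b ⟧ * ⟦ twist q c ⟧ * ⟦ twist q d ⟧
      ≡⟨ cong (λ x → x * ⟦ twist q c ⟧ * ⟦ twist q d ⟧) (sym (⟦⊗⟧ (twist q a) (twist q b))) ⟩
    ⟦ twist q a ⊗ twist q b ⟧ * ⟦ twist q c ⟧ * ⟦ twist q d ⟧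
      ≡⟨ cong (_* ⟦ twist q d ⟧) (sym (⟦⊗⟧ (twist q a ⊗ twist q b) (twist q c))) ⟩
    ⟦ twist q a ⊗ twist q b ⊗ twist q c ⟧ * ⟦ twist q d ⟧
      ≡⟨ sym (⟦⊗⟧ (twist q a ⊗ twist q b ⊗ twist q c) (twist q d)) ⟩
    ⟦ twist q a ⊗ twist q b ⊗ twist q c ⊗ twist q d ⟧
      ≡⟨ cong₂ (λ i j → ⟦ + 1 ·α^ i ·β^ j ⟧) (quadratic-double 35 10 q a b c d p weights)
                                              (quadratic-double 21 6 q a b c d p weights) ⟩
    ⟦ twist (q Nat.* 2) p ⟧ ∎

  odd-from-monomials : ∀ r →
    ⟦ ψ (2 Nat.* (r Nat.+ 2) Nat.+ 1) ⟧
      ≡ ⟦ ψ (r Nat.+ 2 Nat.+ 2) ⊗ ψ (r Nat.+ 2) ⊗^ 3 ⟧ - ⟦ ψ (r Nat.+ 1) ⊗ ψ (r Nat.+ 2 Nat.+ 1) ⊗^ 3 ⟧ →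
    OddRecurrence Ψ r
  odd-from-monomials r e = trans e (cong₂ _-_ (term (ψ (r Nat.+ 2 Nat.+ 2)) (ψ (r Nat.+ 2)))
                                              (term (ψ (r Nat.+ 1)) (ψ (r Nat.+ 2 Nat.+ 1))))
    where
    term : ∀ m m′ → ⟦ m ⊗ m′ ⊗^ 3 ⟧ ≡ ⟦ m ⟧ * ⟦ m′ ⟧ ^ 3
    term m m′ = trans (⟦⊗⟧ m (m′ ⊗^ 3)) (cong (⟦ m ⟧ *_) (⟦⊗^⟧ m′ 3))

  even-from-monomials : ∀ r →
    ⟦ ψ 2 ⊗ ψ (2 Nat.* (r Nat.+ 3)) ⟧
      ≡ ⟦ ψ (r Nat.+ 3) ⊗ (ψ (r Nat.+ 3 Nat.+ 2) ⊗ ψ (r Nat.+ 2) ⊗^ 2) ⟧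
        - ⟦ ψ (r Nat.+ 3) ⊗ (ψ (r Nat.+ 1) ⊗ ψ (r Nat.+ 3 Nat.+ 1) ⊗^ 2) ⟧ →
    EvenRecurrence Ψ r
  even-from-monomials r e = begin
    Ψ 2 * Ψ (2 Nat.* (r Nat.+ 3))                ≡⟨ sym (⟦⊗⟧ (ψ 2) (ψ (2 Nat.* (r Nat.+ 3)))) ⟩
    ⟦ ψ 2 ⊗ ψ (2 Nat.* (r Nat.+ 3)) ⟧            ≡⟨ e ⟩
    ⟦ ψ (r Nat.+ 3) ⊗ (ψ (r Nat.+ 3 Nat.+ 2) ⊗ ψ (r Nat.+ 2) ⊗^ 2) ⟧
      - ⟦ ψ (r Nat.+ 3) ⊗ (ψ (r Nat.+ 1) ⊗ ψ (r Nat.+ 3 Nat.+ 1) ⊗^ 2) ⟧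
                                                  ≡⟨ cong₂ _-_ (term (ψ (r Nat.+ 3 Nat.+ 2)) (ψ (r Nat.+ 2)))
                                                               (term (ψ (r Nat.+ 1)) (ψ (r Nat.+ 3 Nat.+ 1))) ⟩
    x * (Ψ (r Nat.+ 3 Nat.+ 2) * Ψ (r Nat.+ 2) ^ 2) - x * (Ψ (r Nat.+ 1) * Ψ (r Nat.+ 3 Nat.+ 1) ^ 2)
                                                  ≡⟨ sym (*-distribˡ-- x _ _) ⟩
    x * (Ψ (r Nat.+ 3 Nat.+ 2) * Ψ (r Nat.+ 2) ^ 2 - Ψ (r Nat.+ 1) * Ψ (r Nat.+ 3 Nat.+ 1) ^ 2) ∎
    where
    x : ℤ
    x = Ψ (r Nat.+ 3)
    term : ∀ m m′ → ⟦ ψ (r Nat.+ 3) ⊗ (m ⊗ m′ ⊗^ 2) ⟧ ≡ x * (⟦ m ⟧ * ⟦ m′ ⟧ ^ 2)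
    term m m′ = trans (⟦⊗⟧ (ψ (r Nat.+ 3)) (m ⊗ m′ ⊗^ 2))
                      (cong (x *_) (trans (⟦⊗⟧ m (m′ ⊗^ 2)) (cong (⟦ m ⟧ *_) (⟦⊗^⟧ m′ 2))))

  odd-base : ∀ r → r < 7 → OddRecurrence Ψ r
  odd-base 0 _ = odd-from-monomials 0 (β-step′ (+ 1) 17 9)
  odd-base 1 _ = odd-from-monomials 1 (self-cancel 35 21 (- + 1 ·α^ 35 ·β^ 19))
  odd-base 2 _ = odd-from-monomials 2 (β-step (- + 1) 57 33)
  odd-base 3 _ = odd-from-monomials 3 (zero-minus (+ 1 ·α^ 86 ·β^ 51) 86 51)
  odd-base 4 _ = odd-from-monomials 4 (minus-zero (- + 1 ·α^ 120 ·β^ 72) 122 73)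
  odd-base 5 _ = odd-from-monomials 5 (zero-minus (+ 1 ·α^ 160 ·β^ 96) 162 97)
  odd-base 6 _ = odd-from-monomials 6 (minus-zero (- + 1 ·α^ 206 ·β^ 123) 206 123)
  odd-base (suc (suc (suc (suc (suc (suc (suc _))))))) (s≤s (s≤s (s≤s (s≤s (s≤s (s≤s (s≤s ())))))))

  even-base : ∀ r → r < 7 → EvenRecurrence Ψ r
  even-base 0 _ = even-from-monomials 0 (β-step′ (+ 1) 27 15)
  even-base 1 _ = even-from-monomials 1 (β-step (- + 1) 47 27)
  even-base 2 _ = even-from-monomials 2 (zero-minus (+ 1 ·α^ 73 ·β^ 43) 74 43)
  even-base 3 _ = even-from-monomials 3 (minus-zero (- + 1 ·α^ 104 ·β^ 62) 106 63)
  even-base 4 _ = even-from-monomials 4 (minus-zero (+ 0 ·α^ 142 ·β^ 85) 142 85)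
  even-base 5 _ = even-from-monomials 5 (zero-minus (+ 1 ·α^ 184 ·β^ 110) 186 111)
  even-base 6 _ = even-from-monomials 6 (minus-zero (- + 1 ·α^ 233 ·β^ 139) 234 139)
  even-base (suc (suc (suc (suc (suc (suc (suc _))))))) (s≤s (s≤s (s≤s (s≤s (s≤s (s≤s (s≤s ())))))))

  -- The recurrences at k = 7q + r follow from those at r by twisting.
  Ψ-odd : ∀ k → OddRecurrence Ψ k
  Ψ-odd k with divide7 k
  ... | q , r , r<7 , refl = begin
    Ψ (2 Nat.* (x Nat.+ r Nat.+ 2) Nat.+ 1)
      ≡⟨ Ψ-at (q Nat.* 2) (2 Nat.* (r Nat.+ 2) Nat.+ 1) index ⟩
    ⟦ twist (q Nat.* 2) (2 Nat.* (r Nat.+ 2) Nat.+ 1) ⟧ * Ψ (2 Nat.* (r Nat.+ 2) Nat.+ 1)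
      ≡⟨ odd-twist (t (r Nat.+ 2 Nat.+ 2)) (t (r Nat.+ 2)) (t (r Nat.+ 1)) (t (r Nat.+ 2 Nat.+ 1))
                   (Ψ (2 Nat.* (r Nat.+ 2) Nat.+ 1)) (Ψ (r Nat.+ 2 Nat.+ 2)) (Ψ (r Nat.+ 2))
                   (Ψ (r Nat.+ 1)) (Ψ (r Nat.+ 2 Nat.+ 1))
                   first-term second-term (odd-base r r<7) ⟩
    (t (r Nat.+ 2 Nat.+ 2) * Ψ (r Nat.+ 2 Nat.+ 2)) * (t (r Nat.+ 2) * Ψ (r Nat.+ 2)) ^ 3
      - (t (r Nat.+ 1) * Ψ (r Nat.+ 1)) * (t (r Nat.+ 2 Nat.+ 1) * Ψ (r Nat.+ 2 Nat.+ 1)) ^ 3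
      ≡⟨ sym (cong₂ _-_
           (cong₂ _*_ (Ψ-at q _ (+-assoc₃ x r 2 2)) (cong (_^ 3) (Ψ-at q _ (ℕP.+-assoc x r 2))))
           (cong₂ _*_ (Ψ-at q _ (ℕP.+-assoc x r 1)) (cong (_^ 3) (Ψ-at q _ (+-assoc₃ x r 2 1))))) ⟩
    Ψ (x Nat.+ r Nat.+ 2 Nat.+ 2) * Ψ (x Nat.+ r Nat.+ 2) ^ 3
      - Ψ (x Nat.+ r Nat.+ 1) * Ψ (x Nat.+ r Nat.+ 2 Nat.+ 1) ^ 3 ∎
    where
    x : ℕ
    x = q Nat.* 7
    t : ℕ → ℤ
    t n = ⟦ twist q n ⟧
    index : 2 Nat.* (x Nat.+ r Nat.+ 2) Nat.+ 1 ≡ q Nat.* 2 Nat.* 7 Nat.+ (2 Nat.* (r Nat.+ 2) Nat.+ 1)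
    index = trans (cong (Nat._+ 1) (doubled-index q r 2)) (ℕP.+-assoc (q Nat.* 2 Nat.* 7) _ 1)
    first-term : t (r Nat.+ 2 Nat.+ 2) * t (r Nat.+ 2) * t (r Nat.+ 2) * t (r Nat.+ 2)
               ≡ ⟦ twist (q Nat.* 2) (2 Nat.* (r Nat.+ 2) Nat.+ 1) ⟧
    first-term = twist-product q (r Nat.+ 2 Nat.+ 2) (r Nat.+ 2) (r Nat.+ 2) (r Nat.+ 2) _ (proj₁ (odd-weights r))
    second-term : t (r Nat.+ 1) * t (r Nat.+ 2 Nat.+ 1) * t (r Nat.+ 2 Nat.+ 1) * t (r Nat.+ 2 Nat.+ 1)
                ≡ ⟦ twist (q Nat.* 2) (2 Nat.* (r Nat.+ 2) Nat.+ 1) ⟧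
    second-term = twist-product q (r Nat.+ 1) (r Nat.+ 2 Nat.+ 1) (r Nat.+ 2 Nat.+ 1) (r Nat.+ 2 Nat.+ 1) _
                                (proj₂ (odd-weights r))

  Ψ-even : ∀ k → EvenRecurrence Ψ k
  Ψ-even k with divide7 k
  ... | q , r , r<7 , refl = begin
    Ψ 2 * Ψ (2 Nat.* (x Nat.+ r Nat.+ 3))
      ≡⟨ cong (Ψ 2 *_) (Ψ-at (q Nat.* 2) (2 Nat.* (r Nat.+ 3)) (doubled-index q r 3)) ⟩
    Ψ 2 * (⟦ twist (q Nat.* 2) (2 Nat.* (r Nat.+ 3)) ⟧ * Ψ (2 Nat.* (r Nat.+ 3)))
      ≡⟨ even-twist (Ψ 2) (t (r Nat.+ 3)) (t (r Nat.+ 3 Nat.+ 2)) (t (r Nat.+ 2)) (t (r Nat.+ 1)) (t (r Nat.+ 3 Nat.+ 1))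
                    (Ψ (2 Nat.* (r Nat.+ 3))) (Ψ (r Nat.+ 3)) (Ψ (r Nat.+ 3 Nat.+ 2))
                    (Ψ (r Nat.+ 2)) (Ψ (r Nat.+ 1)) (Ψ (r Nat.+ 3 Nat.+ 1))
                    first-term second-term (even-base r r<7) ⟩
    (t (r Nat.+ 3) * Ψ (r Nat.+ 3))
      * ((t (r Nat.+ 3 Nat.+ 2) * Ψ (r Nat.+ 3 Nat.+ 2)) * (t (r Nat.+ 2) * Ψ (r Nat.+ 2)) ^ 2
         - (t (r Nat.+ 1) * Ψ (r Nat.+ 1)) * (t (r Nat.+ 3 Nat.+ 1) * Ψ (r Nat.+ 3 Nat.+ 1)) ^ 2)
      ≡⟨ sym (cong₂ _*_ (Ψ-at q _ (ℕP.+-assoc x r 3)) (cong₂ _-_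
           (cong₂ _*_ (Ψ-at q _ (+-assoc₃ x r 3 2)) (cong (_^ 2) (Ψ-at q _ (ℕP.+-assoc x r 2))))
           (cong₂ _*_ (Ψ-at q _ (ℕP.+-assoc x r 1)) (cong (_^ 2) (Ψ-at q _ (+-assoc₃ x r 3 1)))))) ⟩
    Ψ (x Nat.+ r Nat.+ 3)
      * (Ψ (x Nat.+ r Nat.+ 3 Nat.+ 2) * Ψ (x Nat.+ r Nat.+ 2) ^ 2
         - Ψ (x Nat.+ r Nat.+ 1) * Ψ (x Nat.+ r Nat.+ 3 Nat.+ 1) ^ 2) ∎
    where
    x : ℕ
    x = q Nat.* 7
    t : ℕ → ℤ
    t n = ⟦ twist q n ⟧
    first-term : t (r Nat.+ 3) * t (r Nat.+ 3 Nat.+ 2) * t (r Nat.+ 2) * t (r Nat.+ 2)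
               ≡ ⟦ twist (q Nat.* 2) (2 Nat.* (r Nat.+ 3)) ⟧
    first-term = twist-product q (r Nat.+ 3) (r Nat.+ 3 Nat.+ 2) (r Nat.+ 2) (r Nat.+ 2) _ (proj₁ (even-weights r))
    second-term : t (r Nat.+ 3) * t (r Nat.+ 1) * t (r Nat.+ 3 Nat.+ 1) * t (r Nat.+ 3 Nat.+ 1)
                ≡ ⟦ twist (q Nat.* 2) (2 Nat.* (r Nat.+ 3)) ⟧
    second-term = twist-product q (r Nat.+ 3) (r Nat.+ 1) (r Nat.+ 3 Nat.+ 1) (r Nat.+ 3 Nat.+ 1) _
                                (proj₂ (even-weights r))

  Ψ-isHSeq : IsHSeq α Ψ
  Ψ-isHSeq = refl , refl , Ψ₂ , ℤP.-1*i≡-i _ , ℤP.*-identityˡ _ , Ψ-odd , Ψ-even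
    where
    Ψ₂ : Ψ 2 ≡ - (α ^ 2 * (α - + 1))
    Ψ₂ = trans (ℤP.-1*i≡-i _) (cong (λ b → - (α ^ 2 * b)) (ℤP.^-identityʳ β))

  -- ψ_{ρ + 7kt} = u^k ψ_ρ with u = (A^k)^{t²}B^{tρ}.
  Ψ-residue-class : ∀ k t ρ →
    Ψ (ρ Nat.+ t Nat.* (k Nat.* 7))
      ≡ ⟦ + 1 ·α^ quadratic (35 Nat.* k) 10 t ρ ·β^ quadratic (21 Nat.* k) 6 t ρ ⟧ ^ k * Ψ ρ
  Ψ-residue-class k t ρ = trans (Ψ-at (t Nat.* k) ρ (residue-index k t ρ)) (cong (_* Ψ ρ) twist-power)
    where
    a b : ℕ
    a = quadratic (35 Nat.* k) 10 t ρ
    b = quadratic (21 Nat.* k) 6 t ρ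
    twist-power : ⟦ twist (t Nat.* k) ρ ⟧ ≡ ⟦ + 1 ·α^ a ·β^ b ⟧ ^ k
    twist-power = begin
      ⟦ twist (t Nat.* k) ρ ⟧
        ≡⟨ cong₂ (λ i j → ⟦ + 1 ·α^ i ·β^ j ⟧) (quadratic-scale 35 10 t ρ k) (quadratic-scale 21 6 t ρ k) ⟩
      ⟦ + 1 ·α^ a Nat.* k ·β^ b Nat.* k ⟧  ≡⟨ ⟦power⟧ (+ 1) a b k ⟩
      + 1 * ⟦ + 1 ·α^ a ·β^ b ⟧ ^ k        ≡⟨ ℤP.*-identityˡ _ ⟩
      ⟦ + 1 ·α^ a ·β^ b ⟧ ^ k              ∎

  module Powers (α≢0 : α ≢ + 0) (α≢1 : α ≢ + 1) where

    β≢0 : β ≢ + 0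
    β≢0 β≡0 = α≢1 (ℤP.i-j≡0⇒i≡j α (+ 1) β≡0)

    monomial-≢0 : ∀ c a b → c ≢ + 0 → ⟦ c ·α^ a ·β^ b ⟧ ≢ + 0
    monomial-≢0 c a b c≢0 = *-≢0 c≢0 (*-≢0 (^-≢0 a α≢0) (^-≢0 b β≢0))

    monomial-square : ∀ {c} a b → c ≡ + 1 ⊎ c ≡ - + 1 → IsSquare ⟦ c ·α^ a Nat.* 2 ·β^ b Nat.* 2 ⟧
    monomial-square a b (inj₁ refl) =
      ⟦ + 1 ·α^ a ·β^ b ⟧ , monomial-≢0 (+ 1) a b (λ ()) , inj₁ (trans (⟦power⟧ (+ 1) a b 2) (ℤP.*-identityˡ _))
    monomial-square a b (inj₂ refl) =
      ⟦ + 1 ·α^ a ·β^ b ⟧ , monomial-≢0 (+ 1) a b (λ ()) , inj₂ (trans (⟦power⟧ (- + 1) a b 2) (ℤP.-1*i≡-i _))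

    monomial-cube : ∀ {c} a b → c ≡ + 1 ⊎ c ≡ - + 1 → IsCube ⟦ c ·α^ a Nat.* 3 ·β^ b Nat.* 3 ⟧
    monomial-cube a b (inj₁ refl) =
      ⟦ + 1 ·α^ a ·β^ b ⟧ , monomial-≢0 (+ 1) a b (λ ()) , trans (⟦power⟧ (+ 1) a b 3) (ℤP.*-identityˡ _)
    monomial-cube a b (inj₂ refl) =
      - + 1 * ⟦ + 1 ·α^ a ·β^ b ⟧ , *-≢0 { - + 1} (λ ()) (monomial-≢0 (+ 1) a b (λ ())) ,
      trans (⟦power⟧ (- + 1) a b 3) (odd-power ⟦ + 1 ·α^ a ·β^ b ⟧)
      where
      odd-power : ∀ w → - + 1 * (w * (w * (w * + 1)))
                      ≡ - + 1 * w * (- + 1 * w * (- + 1 * w * + 1))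
      odd-power = ℤSolver.solve-∀

    square-class : ∀ ρ → IsSquare (Ψ ρ) → ∀ n → n % 14 ≡ ρ → IsSquare (Ψ n)
    square-class ρ Ψρ-square n n%14≡ρ =
      subst IsSquare (sym (trans (cong Ψ n≡) (Ψ-residue-class 2 t ρ)))
            (square-scale (monomial-≢0 (+ 1) (quadratic 70 10 t ρ) (quadratic 42 6 t ρ) (λ ())) Ψρ-square)
      where
      t : ℕ
      t = n / 14
      n≡ : n ≡ ρ Nat.+ n / 14 Nat.* 14
      n≡ = trans (m≡m%n+[m/n]*n n 14) (cong (Nat._+ n / 14 Nat.* 14) n%14≡ρ)

    cube-class : ∀ ρ → IsCube (Ψ ρ) → ∀ n → n % 21 ≡ ρ → IsCube (Ψ n)
    cube-class ρ Ψρ-cube n n%21≡ρ =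
      subst IsCube (sym (trans (cong Ψ n≡) (Ψ-residue-class 3 t ρ)))
            (cube-scale (monomial-≢0 (+ 1) (quadratic 105 10 t ρ) (quadratic 63 6 t ρ) (λ ())) Ψρ-cube)
      where
      t : ℕ
      t = n / 21
      n≡ : n ≡ ρ Nat.+ n / 21 Nat.* 21
      n≡ = trans (m≡m%n+[m/n]*n n 21) (cong (Nat._+ n / 21 Nat.* 21) n%21≡ρ)

-- The recurrences determine the sequence once h₂ ≠ 0: two solutions agree
-- everywhere, by strong induction (the even recurrence is divided by h₂).
hseq-unique : ∀ α h g → h 2 ≢ + 0 → IsHSeq α h → IsHSeq α g → ∀ n → h n ≡ g n
hseq-unique α h g h₂≢0 (h₀ , h₁ , h₂ , h₃ , h₄ , h-odd , h-even) (g₀ , g₁ , g₂ , g₃ , g₄ , g-odd , g-even) =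
  <-rec Agree agree
  where
  Agree : ℕ → Set
  Agree n = h n ≡ g n

  agree-odd : ∀ k → (∀ {m} → m < 2 Nat.* (k Nat.+ 2) Nat.+ 1 → Agree m) → Agree (2 Nat.* (k Nat.+ 2) Nat.+ 1)
  agree-odd k IH with odd-indices-below k
  ... | b₁ , b₂ , b₃ , b₄ =
    trans (h-odd k)
      (trans (cong₂ _-_ (cong₂ _*_ (IH b₁) (cong (_^ 3) (IH b₂))) (cong₂ _*_ (IH b₃) (cong (_^ 3) (IH b₄))))
             (sym (g-odd k)))

  agree-even : ∀ k → (∀ {m} → m < 2 Nat.* (k Nat.+ 3) → Agree m) → Agree (2 Nat.* (k Nat.+ 3))
  agree-even k IH with even-indices-below k
  ... | b₁ , b₂ , b₃ , b₄ , b₅ = ℤP.*-cancelˡ-≡ (h 2) _ _ {{ℤ.≢-nonZero h₂≢0}} (begin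
    h 2 * h (2 Nat.* (k Nat.+ 3))  ≡⟨ h-even k ⟩
    _                              ≡⟨ cong₂ _*_ (IH b₁) (cong₂ _-_ (cong₂ _*_ (IH b₂) (cong (_^ 2) (IH b₃)))
                                                                    (cong₂ _*_ (IH b₄) (cong (_^ 2) (IH b₅)))) ⟩
    _                              ≡⟨ sym (g-even k) ⟩
    g 2 * g (2 Nat.* (k Nat.+ 3))  ≡⟨ cong (_* g (2 Nat.* (k Nat.+ 3))) (trans g₂ (sym h₂)) ⟩
    h 2 * g (2 Nat.* (k Nat.+ 3))  ∎)

  agree : ∀ n → (∀ {m} → m < n → Agree m) → Agree n
  agree 0 _ = trans h₀ (sym g₀)
  agree 1 _ = trans h₁ (sym g₁)
  agree 2 _ = trans h₂ (sym g₂)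
  agree 3 _ = trans h₃ (sym g₃)
  agree 4 _ = trans h₄ (sym g₄)
  agree (suc (suc (suc (suc (suc j))))) IH with recurrence-shape j
  ... | k , inj₁ e = subst Agree (sym e) (agree-odd k (λ {m} m< → IH (subst (m <_) (sym e) m<)))
  ... | k , inj₂ e = subst Agree (sym e) (agree-even k (λ {m} m< → IH (subst (m <_) (sym e) m<)))

-- The theorem: h coincides with the closed form Ψ, whose values on the
-- listed residue classes are squares, resp. cubes, because ψ_1, ψ_13 are
-- squares and ψ_1, ψ_3, ψ_8, ψ_13, ψ_18, ψ_20 are cubes.
theorem5p8 : (α : ℤ) → α ≢ + 0 → α ≢ + 1 → (h : ℕ → ℤ) → IsHSeq α h →
    ((n : ℕ) → (n % 14 ≡ 1 ⊎ n % 14 ≡ 13) → IsSquare (h n))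
    × ((n : ℕ) → (n % 21 ≡ 1 ⊎ n % 21 ≡ 3 ⊎ n % 21 ≡ 8 ⊎ n % 21 ≡ 13 ⊎ n % 21 ≡ 18 ⊎ n % 21 ≡ 20)
         → IsCube (h n))
theorem5p8 α α≢0 α≢1 h H = squares , cubes
  where
  open ClosedForm α
  open Powers α≢0 α≢1

  h≡Ψ : ∀ n → h n ≡ Ψ n
  h≡Ψ = hseq-unique α h Ψ h₂≢0 H Ψ-isHSeq
    where
    h₂≢0 : h 2 ≢ + 0
    h₂≢0 h₂≡0 = monomial-≢0 (- + 1) 2 1 (λ ()) (trans (sym (trans (proj₁ (proj₂ (proj₂ H)))
                                                               (sym (proj₁ (proj₂ (proj₂ Ψ-isHSeq)))))) h₂≡0)

  squares : (n : ℕ) → (n % 14 ≡ 1 ⊎ n % 14 ≡ 13) → IsSquare (h n)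
  squares n class = subst IsSquare (sym (h≡Ψ n)) (by-class class)
    where
    by-class : (n % 14 ≡ 1 ⊎ n % 14 ≡ 13) → IsSquare (Ψ n)
    by-class (inj₁ e) = square-class 1 (monomial-square 0 0 (inj₁ refl)) n e
    by-class (inj₂ e) = square-class 13 (monomial-square 60 36 (inj₂ refl)) n e

  cubes : (n : ℕ) → (n % 21 ≡ 1 ⊎ n % 21 ≡ 3 ⊎ n % 21 ≡ 8 ⊎ n % 21 ≡ 13 ⊎ n % 21 ≡ 18 ⊎ n % 21 ≡ 20)
        → IsCube (h n)
  cubes n class = subst IsCube (sym (h≡Ψ n)) (by-class class)
    where
    by-class : (n % 21 ≡ 1 ⊎ n % 21 ≡ 3 ⊎ n % 21 ≡ 8 ⊎ n % 21 ≡ 13 ⊎ n % 21 ≡ 18 ⊎ n % 21 ≡ 20)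
             → IsCube (Ψ n)
    by-class (inj₁ e)                               = cube-class 1 (monomial-cube 0 0 (inj₁ refl)) n e
    by-class (inj₂ (inj₁ e))                        = cube-class 3 (monomial-cube 2 1 (inj₂ refl)) n e
    by-class (inj₂ (inj₂ (inj₁ e)))                 = cube-class 8 (monomial-cube 15 9 (inj₁ refl)) n e
    by-class (inj₂ (inj₂ (inj₂ (inj₁ e))))          = cube-class 13 (monomial-cube 40 24 (inj₂ refl)) n e
    by-class (inj₂ (inj₂ (inj₂ (inj₂ (inj₁ e)))))   = cube-class 18 (monomial-cube 77 46 (inj₁ refl)) n e
    by-class (inj₂ (inj₂ (inj₂ (inj₂ (inj₂ e)))))   = cube-class 20 (monomial-cube 95 57 (inj₂ refl)) n e
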